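{- Let $N_1=\{0,1\}$, $I=\mathbb{N}\times N_1$, and let $\mathfrak{G}$ be the group of all permutations $\pi$ of $I$ for which there exist a permutation $\phi_\pi$ of $\mathbb{N}$ and, for each $n\in\mathbb{N}$, a permutation $\pi_n$ of $N_1$ with $\pi(n,m)=(\phi_\pi(n),\pi_n(m))$ for all $(n,m)\in I$. Let $\Sigma_2=\Sigma(I,\mathfrak{G},{\cal I}_0^I)$ and let $\xi=(\nu_0,\mu_0)\in I$. Then for every binary predicate $\rho$ of $\Sigma_2$ there is a finite $K\subseteq\mathbb{N}$ with ${\rm sym}_\mathfrak{G}(\rho)\supseteq\mathfrak{G}(K\times N_1)$, and for every such $K$, for all $\nu\in\mathbb{N}\setminus(K\cup\{\nu_0\})$ and all $\mu\in N_1$: $(\xi,(\nu,\mu))\in\widetilde\rho$ if and only if $\{\xi\}\times((\mathbb{N}\setminus(K\cup\{\nu_0\}))\times N_1)\subseteq\widetilde\rho$.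
   Context: An $n$-ary predicate on a set $I$ is a map $\alpha:I^n\to\{true,false\}$; $\widetilde\alpha=\{\boldsymbol\xi\in I^n\mid\alpha(\boldsymbol\xi)=true\}$ is the corresponding relation (predicates are often identified with these relations). A permutation $\pi$ of $I$ acts on $n$-ary predicates by $(\pi\alpha)(\pi\xi_1,\dots,\pi\xi_n)=\alpha(\xi_1,\dots,\xi_n)$. For a group $\mathfrak{G}$ of permutations of $I$: ${\rm sym}_\mathfrak{G}(\alpha)=\{\pi\in\mathfrak{G}\mid\pi\alpha=\alpha\}$, and for $P\subseteq I$, $\mathfrak{G}(P)=\{\pi\in\mathfrak{G}\mid\pi(\xi)=\xi\text{ for all }\xi\in P\}$. ${\cal I}_0^I$ is the ideal of finite subsets of $I$. The permutation (Henkin–Asser) structure $\Sigma(I,\mathfrak{G},{\cal I}_0^I)=(J_n)_{n\ge0}$ has individual domain $J_0=I$ and, for $n\ge1$, $J_n$ consists of all $n$-ary predicates $\alpha$ on $I$ such that ${\rm sym}_\mathfrak{G}(\alpha)\supseteq\mathfrak{G}(P)$ for some finite $P\subseteq I$; the predicates of the structure are the elements of the $J_n$. -}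

module Defs where

open import Data.Nat using (ℕ)
open import Data.Fin using (Fin)
open import Data.Bool using (Bool)
open import Data.Product using (Σ; _×_; _,_; proj₁)
open import Data.List using (List)
open import Data.List.Membership.Propositional using (_∈_)
open import Function.Bundles using (_↔_; Inverse)
open import Relation.Binary.PropositionalEquality using (_≡_)

N₁ : Set
N₁ = Fin 2

I : Set
I = ℕ × N₁

Perm : Set → Set
Perm A = A ↔ A

InG : Perm I → Set
InG π = Σ (Perm ℕ) λ φ → Σ (ℕ → Perm N₁) λ πs →
  ∀ (n : ℕ) (m : N₁) → Inverse.to π (n , m) ≡ (Inverse.to φ n , Inverse.to (πs n) m)

Pred2 : Set
Pred2 = I → I → Bool

-- action: (πα)(πx, πy) = α(x, y), i.e. (πα)(z, w) = α(π⁻¹z, π⁻¹w)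
act : Perm I → Pred2 → Pred2
act π α z w = α (Inverse.from π z) (Inverse.from π w)

Fixes : Perm I → (I → Set) → Set
Fixes π P = ∀ x → P x → Inverse.to π x ≡ x

-- sym_𝔊(α) ⊇ 𝔊(P)   (πα = α as equality of predicates, i.e. pointwise)
SymContains : Pred2 → (I → Set) → Set
SymContains α P = ∀ (π : Perm I) → InG π → Fixes π P → ∀ z w → act π α z w ≡ α z w

-- finite subsets represented by lists
FinSubsetI : List I → I → Set
FinSubsetI L x = x ∈ L

_×N₁ : List ℕ → I → Set
(K ×N₁) x = proj₁ x ∈ K

-- binary predicates of Σ₂ = Σ(I, 𝔊, I₀^I): α ∈ J₂
InJ2 : Pred2 → Set
InJ2 α = Σ (List I) λ P → SymContains α (FinSubsetI P)

{-# OPTIONS --safe #-}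
-- The pointwise stabiliser in 𝔊 of K × N₁ and of ξ acts transitively on
-- (ℕ ∖ (K ∪ {ν₀})) × N₁: a transposition of two blocks {ν} × N₁ and {ν′} × N₁
-- moves between blocks, and a transposition inside the single block {ν} × N₁
-- moves within a block. Hence ρ (ξ , -) is constant on that set.
module Submission where

open import Defs
open import Data.Nat using (ℕ)
open import Data.Bool using (true)
open import Data.Product using (Σ; _×_; _,_)
open import Data.List using (List)
open import Data.List.Membership.Propositional using (_∉_)
open import Function.Bundles using (_⇔_)
open import Relation.Binary.PropositionalEquality using (_≡_; _≢_)

open import Data.Empty using (⊥-elim)
open import Data.Fin.Properties using () renaming (_≟_ to _≟ᶠ_)
open import Data.List using (map)
open import Data.List.Membership.Propositional using (_∈_)
open import Data.List.Membership.Propositional.Properties using (∈-map⁺)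
open import Data.Nat.Properties using (_≟_)
open import Data.Product using (proj₁)
open import Function.Bundles using (Inverse; mk⇔; mk↔ₛ′)
open import Function.Construct.Identity using (↔-id)
open import Relation.Binary.Definitions using (DecidableEquality)
open import Relation.Binary.PropositionalEquality
  using (refl; sym; trans; cong; cong₂; ≢-sym; module ≡-Reasoning)
open import Relation.Nullary using (yes; no)
open import Relation.Unary using (_⊆_)

open Inverse using (to; from)

module Transposition {A : Set} (_≟ᴬ_ : DecidableEquality A) (a b : A) where

  swap : A → A
  swap x with x ≟ᴬ a | x ≟ᴬ b
  ... | yes _ | _     = b
  ... | no _  | yes _ = a
  ... | no _  | no _  = x

  swap-left : swap a ≡ b
  swap-left with a ≟ᴬ a
  ... | yes _  = refl
  ... | no a≢a = ⊥-elim (a≢a refl)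

  swap-right : swap b ≡ a
  swap-right with b ≟ᴬ a | b ≟ᴬ b
  ... | yes refl | _      = refl
  ... | no _     | yes _  = refl
  ... | no _     | no b≢b = ⊥-elim (b≢b refl)

  swap-other : ∀ {x} → x ≢ a → x ≢ b → swap x ≡ x
  swap-other {x} x≢a x≢b with x ≟ᴬ a | x ≟ᴬ b
  ... | yes x≡a | _       = ⊥-elim (x≢a x≡a)
  ... | no _    | yes x≡b = ⊥-elim (x≢b x≡b)
  ... | no _    | no _    = refl

  swap-involutive : ∀ x → swap (swap x) ≡ x
  swap-involutive x with x ≟ᴬ a | x ≟ᴬ b
  ... | yes refl | _        = swap-right
  ... | no _     | yes refl = swap-left
  ... | no x≢a   | no x≢b   = swap-other x≢a x≢b

  transposition : Perm A
  transposition = mk↔ₛ′ swap swap swap-involutive swap-involutive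

open Transposition using (transposition)

blockwise : Perm ℕ → (ℕ → Perm N₁) → Perm I
blockwise φ πs = mk↔ₛ′ forward backward forward∘backward backward∘forward
  where
  forward : I → I
  forward (n , m) = to φ n , to (πs n) m

  backward : I → I
  backward (n , m) = let k = from φ n in k , from (πs k) m

  forward∘backward : ∀ x → forward (backward x) ≡ x
  forward∘backward (n , m) =
    cong₂ _,_ (Inverse.strictlyInverseˡ φ n) (Inverse.strictlyInverseˡ (πs (from φ n)) m)

  backward∘forward : ∀ x → backward (forward x) ≡ x
  backward∘forward (n , m) = go (from φ (to φ n)) (Inverse.strictlyInverseʳ φ n)
    where
    go : ∀ k → k ≡ n → (k , from (πs k) (to (πs n) m)) ≡ (n , m)
    go _ refl = cong (n ,_) (Inverse.strictlyInverseʳ (πs n) m)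

blockwise-InG : ∀ φ πs → InG (blockwise φ πs)
blockwise-InG φ πs = φ , πs , λ _ _ → refl

twistAt : ℕ → Perm N₁ → ℕ → Perm N₁
twistAt ν τ n with n ≟ ν
... | yes _ = τ
... | no _  = ↔-id N₁

twistAt-self : ∀ ν τ → twistAt ν τ ν ≡ τ
twistAt-self ν τ with ν ≟ ν
... | yes _  = refl
... | no ν≢ν = ⊥-elim (ν≢ν refl)

twistAt-other : ∀ {ν n} τ → n ≢ ν → twistAt ν τ n ≡ ↔-id N₁
twistAt-other {ν} {n} τ n≢ν with n ≟ ν
... | yes n≡ν = ⊥-elim (n≢ν n≡ν)
... | no _    = refl

symContains-⊆ : ∀ {ρ P Q} → P ⊆ Q → SymContains ρ P → SymContains ρ Q
symContains-⊆ P⊆Q symP π π∈G π-fixes-Q = symP π π∈G (λ x x∈P → π-fixes-Q x (P⊆Q x∈P))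

symContains-invariant : ∀ {ρ P π x} → SymContains ρ P → InG π → Fixes π P →
                        to π x ≡ x → ∀ y → ρ x y ≡ ρ x (to π y)
symContains-invariant {ρ} {P} {π} {x} symP π∈G π-fixes-P πx≡x y = begin
  ρ x y                          ≡⟨ cong₂ ρ (sym from-x≡x) (sym (Inverse.strictlyInverseʳ π y)) ⟩
  ρ (from π x) (from π (to π y)) ≡⟨ symP π π∈G π-fixes-P x (to π y) ⟩
  ρ x (to π y)                   ∎
  where
  open ≡-Reasoning
  from-x≡x : from π x ≡ x
  from-x≡x = trans (cong (from π) (sym πx≡x)) (Inverse.strictlyInverseʳ π x)

FixesBlock : Perm I → ℕ → Set
FixesBlock π n = ∀ m → to π (n , m) ≡ (n , m)

∈-∉⇒≢ : ∀ {A : Set} {x y : A} {xs} → x ∈ xs → y ∉ xs → x ≢ y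
∈-∉⇒≢ x∈xs y∉xs refl = y∉xs x∈xs

swapBlocks : ℕ → ℕ → Perm I
swapBlocks ν ν′ = blockwise (transposition _≟_ ν ν′) (λ _ → ↔-id N₁)

swapBlocks-InG : ∀ ν ν′ → InG (swapBlocks ν ν′)
swapBlocks-InG ν ν′ = blockwise-InG (transposition _≟_ ν ν′) (λ _ → ↔-id N₁)

swapBlocks-left : ∀ ν ν′ μ → to (swapBlocks ν ν′) (ν , μ) ≡ (ν′ , μ)
swapBlocks-left ν ν′ μ = cong (_, μ) (Transposition.swap-left _≟_ ν ν′)

swapBlocks-fixes : ∀ {ν ν′ n} → n ≢ ν → n ≢ ν′ → FixesBlock (swapBlocks ν ν′) n
swapBlocks-fixes n≢ν n≢ν′ m = cong (_, m) (Transposition.swap-other _≟_ _ _ n≢ν n≢ν′)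

swapInBlock : ℕ → N₁ → N₁ → Perm I
swapInBlock ν μ μ′ = blockwise (↔-id ℕ) (twistAt ν (transposition _≟ᶠ_ μ μ′))

swapInBlock-InG : ∀ ν μ μ′ → InG (swapInBlock ν μ μ′)
swapInBlock-InG ν μ μ′ = blockwise-InG (↔-id ℕ) (twistAt ν (transposition _≟ᶠ_ μ μ′))

swapInBlock-left : ∀ ν μ μ′ → to (swapInBlock ν μ μ′) (ν , μ) ≡ (ν , μ′)
swapInBlock-left ν μ μ′ = cong (ν ,_) (begin
  to (twistAt ν τ ν) μ ≡⟨ cong (λ σ → to σ μ) (twistAt-self ν τ) ⟩
  to τ μ               ≡⟨ Transposition.swap-left _≟ᶠ_ μ μ′ ⟩
  μ′                   ∎)
  where
  open ≡-Reasoning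
  τ = transposition _≟ᶠ_ μ μ′

swapInBlock-fixes : ∀ {ν μ μ′ n} → n ≢ ν → FixesBlock (swapInBlock ν μ μ′) n
swapInBlock-fixes n≢ν m = cong (λ σ → _ , to σ m) (twistAt-other _ n≢ν)

module _ {ρ : Pred2} {K : List ℕ} (symK : SymContains ρ (K ×N₁)) (ν₀ : ℕ) (μ₀ : N₁) where

  ρ-transport : ∀ π → InG π → (∀ {n} → n ∈ K → FixesBlock π n) → FixesBlock π ν₀ →
                ∀ {y y′} → to π y ≡ y′ → ρ (ν₀ , μ₀) y ≡ ρ (ν₀ , μ₀) y′
  ρ-transport π π∈G fixes-K fixes-ν₀ {y} πy≡y′ =
    trans (symContains-invariant {π = π} symK π∈G (λ (n , m) n∈K → fixes-K n∈K m) (fixes-ν₀ μ₀) y)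
          (cong (ρ (ν₀ , μ₀)) πy≡y′)

  ρ-between-blocks : ∀ {ν ν′} → ν ∉ K → ν′ ∉ K → ν ≢ ν₀ → ν′ ≢ ν₀ →
                     ∀ μ → ρ (ν₀ , μ₀) (ν , μ) ≡ ρ (ν₀ , μ₀) (ν′ , μ)
  ρ-between-blocks {ν} {ν′} ν∉K ν′∉K ν≢ν₀ ν′≢ν₀ μ =
    ρ-transport (swapBlocks ν ν′) (swapBlocks-InG ν ν′)
      (λ n∈K → swapBlocks-fixes (∈-∉⇒≢ n∈K ν∉K) (∈-∉⇒≢ n∈K ν′∉K))
      (swapBlocks-fixes (≢-sym ν≢ν₀) (≢-sym ν′≢ν₀))
      (swapBlocks-left ν ν′ μ)

  ρ-within-block : ∀ {ν} → ν ∉ K → ν ≢ ν₀ → ∀ μ μ′ → ρ (ν₀ , μ₀) (ν , μ) ≡ ρ (ν₀ , μ₀) (ν , μ′)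
  ρ-within-block {ν} ν∉K ν≢ν₀ μ μ′ =
    ρ-transport (swapInBlock ν μ μ′) (swapInBlock-InG ν μ μ′)
      (λ n∈K → swapInBlock-fixes (∈-∉⇒≢ n∈K ν∉K))
      (swapInBlock-fixes (≢-sym ν≢ν₀))
      (swapInBlock-left ν μ μ′)

  ρ-constant : ∀ {ν ν′} → ν ∉ K → ν′ ∉ K → ν ≢ ν₀ → ν′ ≢ ν₀ →
               ∀ μ μ′ → ρ (ν₀ , μ₀) (ν , μ) ≡ ρ (ν₀ , μ₀) (ν′ , μ′)
  ρ-constant ν∉K ν′∉K ν≢ν₀ ν′≢ν₀ μ μ′ =
    trans (ρ-between-blocks ν∉K ν′∉K ν≢ν₀ ν′≢ν₀ μ) (ρ-within-block ν′∉K ν′≢ν₀ μ μ′)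

lemma2p8 : (ν₀ : ℕ) (μ₀ : N₁) (ρ : Pred2) → InJ2 ρ →
    (Σ (List ℕ) λ K → SymContains ρ (K ×N₁)) ×
    (∀ (K : List ℕ) → SymContains ρ (K ×N₁) →
      ∀ (ν : ℕ) → ν ∉ K → ν ≢ ν₀ → ∀ (μ : N₁) →
        (ρ (ν₀ , μ₀) (ν , μ) ≡ true ⇔
          (∀ (ν′ : ℕ) (μ′ : N₁) → ν′ ∉ K → ν′ ≢ ν₀ → ρ (ν₀ , μ₀) (ν′ , μ′) ≡ true)))
lemma2p8 ν₀ μ₀ ρ (P , symP) =
  (map proj₁ P , symContains-⊆ (∈-map⁺ proj₁) symP) ,
  λ K symK ν ν∉K ν≢ν₀ μ → mk⇔
    (λ ρνμ≡true ν′ μ′ ν′∉K ν′≢ν₀ →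
      trans (sym (ρ-constant symK ν₀ μ₀ ν∉K ν′∉K ν≢ν₀ ν′≢ν₀ μ μ′)) ρνμ≡true)
    (λ ρ-true-off-K → ρ-true-off-K ν μ ν∉K ν≢ν₀)
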